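{- Let $S$ be a numerical semigroup with minimal generators $a_1<a_2<\cdots<a_\nu$, multiplicity $\mu=a_1$ and conductor $c$, and suppose $a_2>\frac{c+\mu}{3}$. Let $P=\{a_1,\ldots,a_\nu\}$, $P_1=\{a\in P\setminus\{\mu\}\mid \frac{c+\mu}{3}<a<\frac{c+\mu}{2}\}$, $P_2=\{a\in P\setminus\{\mu\}\mid \frac{c+\mu}{2}\le a<\frac{2}{3}(c+\mu)\}$, $q_1=|P_1|$, $q_2=|P_2|$, and let $\sigma$ be the maximal cardinality of an independent set of Apéry pairs. Then $$\frac{q_1(q_1+1)}{2}+\sigma\cdot\max\{q_1,q_2\}+\nu\ge\mu.$$
   Context: A numerical semigroup is a subset $S\subseteq\mathbb{N}$ containing $0$, closed under addition, with $\mathbb{N}\setminus S$ finite. Its conductor $c=c(S)$ is the least integer $x$ with $x+\mathbb{N}\subseteq S$. $S$ has a unique minimal set of generators; its cardinality is the embedding dimension $\nu(S)$ and its least element is the multiplicity $\mu(S)$. The Apéry set of $S$ is $\mathrm{Ap}(S)=\{s\in S\mid s-\mu\notin S\}$. A pair $(a,b)\in P_1\times P_2$ is an Apéry pair if $a+b\in\mathrm{Ap}(S)$. A set $\{(a_i,b_i)\}_{i=1}^n$ of Apéry pairs is independent if $a_i\ne a_j$ and $b_i\ne b_j$ for all $i\ne j$. -}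

module Defs where

open import Data.Nat using (ℕ; zero; suc; _+_; _*_; _≤_; _<_; _≤?_; _<?_; _≟_)
open import Data.Nat.Properties using ()
open import Data.Product using (Σ; ∃; _×_; _,_; proj₁; proj₂)
open import Data.List using (List; []; _∷_; length; filter; map)
open import Data.List.Membership.Propositional using (_∈_)
open import Data.List.Relation.Unary.All using (All)
open import Data.List.Relation.Unary.Unique.Propositional using (Unique)
open import Relation.Nullary using (¬_; Dec; yes; no)
open import Relation.Nullary.Decidable using (_×-dec_; ¬?)
open import Relation.Binary.PropositionalEquality using (_≡_; _≢_)

record NumericalSemigroup : Set₁ where
  field
    Mem      : ℕ → Set
    dec      : ∀ n → Dec (Mem n)
    zero∈    : Mem 0
    closed   : ∀ {x y} → Mem x → Mem y → Mem (x + y)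
    cofinite : ∃ λ N → ∀ n → N ≤ n → Mem n

open NumericalSemigroup public

IsConductor : NumericalSemigroup → ℕ → Set
IsConductor S c =
  (∀ x → c ≤ x → Mem S x) × (∀ d → (∀ x → d ≤ x → Mem S x) → c ≤ d)

IsMultiplicity : NumericalSemigroup → ℕ → Set
IsMultiplicity S μ = Mem S μ × μ ≢ 0 × (∀ s → Mem S s → s ≢ 0 → μ ≤ s)

IsMinGen : NumericalSemigroup → ℕ → Set
IsMinGen S a =
  Mem S a × a ≢ 0 ×
  ¬ (Σ ℕ λ x → Σ ℕ λ y → Mem S x × Mem S y × x ≢ 0 × y ≢ 0 × x + y ≡ a)

data StrictlyIncreasing : List ℕ → Set where
  []  : StrictlyIncreasing []
  [-] : ∀ {a} → StrictlyIncreasing (a ∷ [])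
  _∷_ : ∀ {a b l} → a < b → StrictlyIncreasing (b ∷ l) → StrictlyIncreasing (a ∷ b ∷ l)

IsMinGenList : NumericalSemigroup → List ℕ → Set
IsMinGenList S gens = StrictlyIncreasing gens × (∀ a → (a ∈ gens → IsMinGen S a) × (IsMinGen S a → a ∈ gens))

-- Membership conditions defining P₁ and P₂ (for a ∈ P), with c + μ fixed:
--   P₁ : a ≠ μ, (c+μ)/3 < a < (c+μ)/2
--   P₂ : a ≠ μ, (c+μ)/2 ≤ a < 2(c+μ)/3
InP₁cond : ℕ → ℕ → ℕ → Set
InP₁cond c μ a = a ≢ μ × (c + μ < 3 * a) × (2 * a < c + μ)

InP₂cond : ℕ → ℕ → ℕ → Set
InP₂cond c μ a = a ≢ μ × (c + μ ≤ 2 * a) × (3 * a < 2 * (c + μ))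

InP₁cond? : ∀ c μ a → Dec (InP₁cond c μ a)
InP₁cond? c μ a = ¬? (a ≟ μ) ×-dec ((suc (c + μ) ≤? 3 * a) ×-dec (suc (2 * a) ≤? c + μ))

InP₂cond? : ∀ c μ a → Dec (InP₂cond c μ a)
InP₂cond? c μ a = ¬? (a ≟ μ) ×-dec ((c + μ ≤? 2 * a) ×-dec (suc (3 * a) ≤? 2 * (c + μ)))

P₁ : ℕ → ℕ → List ℕ → List ℕ
P₁ c μ gens = filter (InP₁cond? c μ) gens

P₂ : ℕ → ℕ → List ℕ → List ℕ
P₂ c μ gens = filter (InP₂cond? c μ) gens

InApery : NumericalSemigroup → ℕ → ℕ → Set
InApery S μ s = Mem S s × ¬ (Σ ℕ λ t → Mem S t × t + μ ≡ s)

IsAperyPair : NumericalSemigroup → ℕ → ℕ → List ℕ → ℕ × ℕ → Set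
IsAperyPair S c μ gens (a , b) =
  a ∈ P₁ c μ gens × b ∈ P₂ c μ gens × InApery S μ (a + b)

-- An independent set of Apéry pairs, given as a list: all entries are Apéry
-- pairs, first components pairwise distinct, second components pairwise
-- distinct (hence the pairs are distinct and length = cardinality).
IsIndependent : NumericalSemigroup → ℕ → ℕ → List ℕ → List (ℕ × ℕ) → Set
IsIndependent S c μ gens ps =
  All (IsAperyPair S c μ gens) ps × Unique (map proj₁ ps) × Unique (map proj₂ ps)

IsMaxIndepSize : NumericalSemigroup → ℕ → ℕ → List ℕ → ℕ → Set
IsMaxIndepSize S c μ gens σ =
  (Σ (List (ℕ × ℕ)) λ ps → IsIndependent S c μ gens ps × length ps ≡ σ) ×
  (∀ ps → IsIndependent S c μ gens ps → length ps ≤ σ)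

module Submission where

-- Let S have multiplicity μ, conductor c, minimal generators μ = a₁ < a₂ < ⋯ with
-- a₂ > (c + μ)/3, and put K = c + μ.  The Apéry set Ap(S) meets every residue class
-- mod μ, so μ ≤ the length of any list containing μ and all
-- positive Apéry elements (μ-≤-length).  We exhibit such a list of the required size.
-- By strong induction every positive Apéry element exceeds K/3 (Ap-above-third), and it
-- lies below K (Ap-<-c+μ).  Hence a positive Apéry element that is not a generator is a
-- sum x + y of two generators x ≤ y (a third summand would push it past K): then x ∈ P₁
-- and either y ∈ P₁ (at most q₁(q₁+1)/2 such sums) or (x , y) is an Apéry pair.  Apéry
-- pairs are the edges of a bipartite graph between P₁ and P₂ whose matchings are the
-- independent sets; a Kőnig-type argument (no augmenting paths of length 1 or 3 for a
-- maximum matching) covers all its edges by a list of length σ · max(q₁, q₂)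
-- (BipartiteGraph.edge-cover).

open import Defs
open import Data.Empty using (⊥)
open import Data.Fin using (Fin; toℕ)
import Data.Fin.Properties as Fin
open import Data.Nat using (ℕ; zero; suc; _+_; _*_; _∸_; _≤_; _<_; _≤?_; _<?_; _≟_; _⊔_; z≤n; s≤s; ≢-nonZero)
open import Data.Nat.Properties
open import Algebra.Properties.CommutativeSemigroup +-commutativeSemigroup
  using () renaming (interchange to +-interchange)
open import Data.Nat.DivMod using (_/_; _%_; m*n/n≡m; n%n≡0; [m+kn]%n≡m%n; m<n⇒m%n≡m)
open import Data.Nat.Induction using (<-rec)
open import Data.Nat.Tactic.RingSolver using (solve-∀)
open import Data.Product using (Σ; ∃; _×_; _,_; proj₁; proj₂; uncurry)
open import Data.List using (List; []; _∷_; _++_; length; map; filter; concatMap; cartesianProduct; tabulate)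
open import Data.List.Properties using (length-map; length-++; length-tabulate)
open import Data.List.Membership.Propositional using (_∈_; _∉_; lose)
open import Data.List.Membership.Propositional.Properties
  using (∈-∃++; ∈-filter⁺; ∈-map⁺; ∈-map⁻; ∈-++⁺ˡ; ∈-++⁺ʳ; ∈-concatMap⁺; ∈-cartesianProduct⁺; ∈-tabulate⁻)
import Data.List.Membership.DecPropositional as DecMembership
open import Data.List.Membership.DecPropositional _≟_ using (_∈?_)
open import Data.List.Relation.Unary.Any as Any using (Any; here; there; any?)
open import Data.List.Relation.Unary.All as All using (All; _∷_)
open import Data.List.Relation.Unary.All.Properties using (¬Any⇒All¬)
open import Data.List.Relation.Unary.AllPairs using (_∷_)
open import Data.List.Relation.Unary.Unique.Propositional using (Unique)
open import Data.List.Relation.Unary.Unique.Propositional.Properties using (tabulate⁺)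
open import Data.List.Relation.Binary.Permutation.Propositional using (_↭_; ↭-sym; ↭⇒↭ₛ)
open import Data.List.Relation.Binary.Permutation.Propositional.Properties
  using (shift; ∈-resp-↭; ↭-length; All-resp-↭) renaming (map⁺ to ↭-map⁺)
import Data.List.Relation.Binary.Permutation.Setoid.Properties as SetoidPermutation
open import Relation.Nullary using (¬_; Dec; yes; no)
open import Relation.Nullary.Negation using (contradiction)
open import Relation.Nullary.Decidable using (¬?; _×-dec_; decidable-stable)
open import Relation.Unary using (Decidable)
open import Relation.Binary.Definitions using (DecidableEquality)
open import Relation.Binary.PropositionalEquality
  using (_≡_; _≢_; refl; sym; trans; cong; cong₂; subst; setoid; module ≡-Reasoning)

module _ {A : Set} where

  extract : {x : A} {xs : List A} → x ∈ xs → ∃ λ ys → xs ↭ x ∷ ys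
  extract x∈xs with ys , zs , refl ← ∈-∃++ x∈xs = ys ++ zs , shift _ ys zs

  Unique-resp-↭ : {xs ys : List A} → xs ↭ ys → Unique xs → Unique ys
  Unique-resp-↭ p = SetoidPermutation.Unique-resp-↭ (setoid A) (↭⇒↭ₛ p)

  unique-length-≤ : {xs L : List A} → Unique xs → (∀ {z} → z ∈ xs → z ∈ L) → length xs ≤ length L
  unique-length-≤ {[]} _ _ = z≤n
  unique-length-≤ {x ∷ xs} {L} (x∉xs ∷ u) xs⊆L
    with L′ , L↭ ← extract (xs⊆L (here refl)) =
    subst (suc (length xs) ≤_) (sym (↭-length L↭)) (s≤s (unique-length-≤ u xs⊆L′))
    where
    xs⊆L′ : ∀ {z} → z ∈ xs → z ∈ L′
    xs⊆L′ z∈xs with ∈-resp-↭ L↭ (xs⊆L (there z∈xs))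
    ... | here z≡x = contradiction (sym z≡x) (All.lookup x∉xs z∈xs)
    ... | there z∈L′ = z∈L′

  length-filter-split : {P : A → Set} (P? : Decidable P) (xs : List A) →
    length (filter P? xs) + length (filter (λ x → ¬? (P? x)) xs) ≡ length xs
  length-filter-split P? [] = refl
  length-filter-split P? (x ∷ xs) with P? x
  ... | yes _ = cong suc (length-filter-split P? xs)
  ... | no _ = trans (+-suc _ _) (cong suc (length-filter-split P? xs))

module _ {A : Set} (_≟A_ : DecidableEquality A) where
  open DecMembership _≟A_ using () renaming (_∈?_ to _∈A?_)

  outside : List A → List A → List A
  outside B Y = filter (λ y → ¬? (y ∈A? B)) Y

  length-outside : (B Y : List A) → Unique B → (∀ {z} → z ∈ B → z ∈ Y) →
    length (outside B Y) + length B ≤ length Y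
  length-outside B Y uB B⊆Y = begin
    length (outside B Y) + length B                  ≤⟨ +-monoʳ-≤ _ B≤inside ⟩
    length (outside B Y) + length (filter (_∈A? B) Y) ≡⟨ +-comm (length (outside B Y)) _ ⟩
    length (filter (_∈A? B) Y) + length (outside B Y) ≡⟨ length-filter-split (_∈A? B) Y ⟩
    length Y                                         ∎
    where
    open ≤-Reasoning
    B≤inside : length B ≤ length (filter (_∈A? B) Y)
    B≤inside = unique-length-≤ uB (λ z∈B → ∈-filter⁺ (_∈A? B) (B⊆Y z∈B) z∈B)

pairSums : List ℕ → List ℕ
pairSums [] = []
pairSums (x ∷ xs) = map (x +_) (x ∷ xs) ++ pairSums xs

∈-pairSums : {a b : ℕ} {l : List ℕ} → a ∈ l → b ∈ l → a + b ∈ pairSums l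
∈-pairSums {l = x ∷ xs} (here refl) b∈l = ∈-++⁺ˡ (∈-map⁺ (x +_) b∈l)
∈-pairSums {a} {l = x ∷ xs} (there a∈xs) (here refl) =
  ∈-++⁺ˡ (subst (_∈ map (x +_) (x ∷ xs)) (+-comm x a) (∈-map⁺ (x +_) (there a∈xs)))
∈-pairSums {l = x ∷ xs} (there a∈xs) (there b∈xs) = ∈-++⁺ʳ _ (∈-pairSums a∈xs b∈xs)

length-pairSums : (l : List ℕ) → length (pairSums l) ≡ length l * (length l + 1) / 2
length-pairSums l = sym (begin
  length l * (length l + 1) / 2       ≡⟨ cong (_/ 2) (sym (twice l)) ⟩
  length (pairSums l) * 2 / 2         ≡⟨ m*n/n≡m (length (pairSums l)) 2 ⟩
  length (pairSums l)                 ∎)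
  where
  open ≡-Reasoning
  step : ∀ q → suc q * 2 + q * (q + 1) ≡ suc q * (suc q + 1)
  step = solve-∀
  twice : (l : List ℕ) → length (pairSums l) * 2 ≡ length l * (length l + 1)
  twice [] = refl
  twice (x ∷ xs) = begin
    length (map (x +_) (x ∷ xs) ++ pairSums xs) * 2          ≡⟨ cong (_* 2) (length-++ (map (x +_) (x ∷ xs))) ⟩
    (length (map (x +_) (x ∷ xs)) + length (pairSums xs)) * 2 ≡⟨ cong (λ n → (n + length (pairSums xs)) * 2) (length-map (x +_) (x ∷ xs)) ⟩
    (suc q + length (pairSums xs)) * 2                         ≡⟨ *-distribʳ-+ 2 (suc q) (length (pairSums xs)) ⟩
    suc q * 2 + length (pairSums xs) * 2                       ≡⟨ cong (suc q * 2 +_) (twice xs) ⟩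
    suc q * 2 + q * (q + 1)                                    ≡⟨ step q ⟩
    suc q * (suc q + 1)                                        ∎
    where q = length xs

module _ {A B : Set} where

  length-cartesianProduct : (xs : List A) (ys : List B) →
    length (cartesianProduct xs ys) ≡ length xs * length ys
  length-cartesianProduct [] ys = refl
  length-cartesianProduct (x ∷ xs) ys = begin
    length (map (x ,_) ys ++ cartesianProduct xs ys)            ≡⟨ length-++ (map (x ,_) ys) ⟩
    length (map (x ,_) ys) + length (cartesianProduct xs ys)     ≡⟨ cong₂ _+_ (length-map (x ,_) ys) (length-cartesianProduct xs ys) ⟩
    length ys + length xs * length ys                            ∎
    where open ≡-Reasoning

  ∈-concatMap : (f : A → List B) {x : A} {xs : List A} {y : B} → x ∈ xs → y ∈ f x → y ∈ concatMap f xs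
  ∈-concatMap f x∈xs y∈fx = ∈-concatMap⁺ f (lose x∈xs y∈fx)

  -- If each block f x has at most n − k entries, concatMap f xs has at most |xs|·(n − k)
  -- (stated without truncated subtraction).
  length-concatMap-≤ : (f : A → List B) (xs : List A) (k n : ℕ) →
    (∀ {x} → x ∈ xs → length (f x) + k ≤ n) →
    length (concatMap f xs) + length xs * k ≤ length xs * n
  length-concatMap-≤ f [] k n bound = z≤n
  length-concatMap-≤ f (x ∷ xs) k n bound = begin
    length (f x ++ concatMap f xs) + (k + length xs * k)        ≡⟨ cong (_+ (k + length xs * k)) (length-++ (f x)) ⟩
    length (f x) + length (concatMap f xs) + (k + length xs * k) ≡⟨ +-interchange (length (f x)) _ k _ ⟩
    (length (f x) + k) + (length (concatMap f xs) + length xs * k) ≤⟨ +-mono-≤ (bound (here refl)) (length-concatMap-≤ f xs k n (λ y∈xs → bound (there y∈xs))) ⟩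
    n + length xs * n                                             ∎
    where
    open ≤-Reasoning

module BipartiteGraph {U W : Set} (_≟U_ : DecidableEquality U) (_≟W_ : DecidableEquality W)
  (Edge : U × W → Set) (edge? : Decidable Edge) (X : List U) (Y : List W)
  (edge-left : ∀ {x y} → Edge (x , y) → x ∈ X) (edge-right : ∀ {x y} → Edge (x , y) → y ∈ Y) where

  open DecMembership _≟U_ using () renaming (_∈?_ to _∈U?_)
  open DecMembership _≟W_ using () renaming (_∈?_ to _∈W?_)

  IsMatching : List (U × W) → Set
  IsMatching ps = All Edge ps × Unique (map proj₁ ps) × Unique (map proj₂ ps)

  matching-resp-↭ : {ps qs : List (U × W)} → ps ↭ qs → IsMatching ps → IsMatching qs
  matching-resp-↭ p (edges , u₁ , u₂) =
    All-resp-↭ p edges , Unique-resp-↭ (↭-map⁺ proj₁ p) u₁ , Unique-resp-↭ (↭-map⁺ proj₂ p) u₂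

  -- It admits no
  -- augmenting path of length 1 or 3; hence every edge lies in A × B or in the row or
  -- column (towards unmatched vertices) of a matched edge, one line per matched edge,
  -- each of length at most max(|X|, |Y|) − σ.
  module MaximumMatching (σ : ℕ) (M : List (U × W)) (matching : IsMatching M) (|M|≡σ : length M ≡ σ)
    (maximal : ∀ ps → IsMatching ps → length ps ≤ σ) where

    A : List U
    A = map proj₁ M

    B : List W
    B = map proj₂ M

    |A|≡σ : length A ≡ σ
    |A|≡σ = trans (length-map proj₁ M) |M|≡σ

    |B|≡σ : length B ≡ σ
    |B|≡σ = trans (length-map proj₂ M) |M|≡σ

    A⊆X : ∀ {x} → x ∈ A → x ∈ X
    A⊆X x∈A with _ , e∈M , refl ← ∈-map⁻ proj₁ x∈A = edge-left (All.lookup (proj₁ matching) e∈M)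

    B⊆Y : ∀ {y} → y ∈ B → y ∈ Y
    B⊆Y y∈B with _ , e∈M , refl ← ∈-map⁻ proj₂ y∈B = edge-right (All.lookup (proj₁ matching) e∈M)

    no-larger-matching : ∀ ps → IsMatching ps → length ps ≢ suc σ
    no-larger-matching ps m |ps|≡1+σ = <-irrefl refl (subst (_≤ σ) |ps|≡1+σ (maximal ps m))

    no-free-edge : ∀ {x y} → x ∉ A → y ∉ B → ¬ Edge (x , y)
    no-free-edge x∉A y∉B xy =
      no-larger-matching ((_ , _) ∷ M)
        (xy ∷ proj₁ matching , ¬Any⇒All¬ A x∉A ∷ proj₁ (proj₂ matching) , ¬Any⇒All¬ B y∉B ∷ proj₂ (proj₂ matching))
        (cong suc |M|≡σ)

    -- No augmenting path of length 3: if a matched edge (a , b) has an unmatched neighbour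
    -- x of b and an unmatched neighbour y of a, replacing it by (x , b) and (a , y) grows M.
    no-free-detour : ∀ {a b x y} → (a , b) ∈ M → x ∉ A → Edge (x , b) → y ∉ B → Edge (a , y) → ⊥
    no-free-detour {a} {b} {x} {y} ab∈M x∉A xb y∉B ay
      with M′ , M↭ ← extract ab∈M
      with ab ∷ edges′ , a∉A′ ∷ uA′ , b∉B′ ∷ uB′ ← matching-resp-↭ M↭ matching =
      no-larger-matching ((x , b) ∷ (a , y) ∷ M′)
        (xb ∷ ay ∷ edges′ , ¬Any⇒All¬ _ x∉aA′ ∷ a∉A′ ∷ uA′ , ¬Any⇒All¬ _ b∉yB′ ∷ ¬Any⇒All¬ _ y∉B′ ∷ uB′)
        (cong suc (trans (sym (↭-length M↭)) |M|≡σ))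
      where
      x∉aA′ : x ∉ a ∷ map proj₁ M′
      x∉aA′ x∈ = x∉A (∈-resp-↭ (↭-sym (↭-map⁺ proj₁ M↭)) x∈)
      y∉B′ : y ∉ map proj₂ M′
      y∉B′ y∈ = y∉B (∈-resp-↭ (↭-sym (↭-map⁺ proj₂ M↭)) (there y∈))
      b∉yB′ : b ∉ y ∷ map proj₂ M′
      b∉yB′ (here refl) = y∉B (∈-map⁺ proj₂ ab∈M)
      b∉yB′ (there b∈B′) = All.lookup b∉B′ b∈B′ refl

    HasFreeNeighbour : U → Set
    HasFreeNeighbour a = Any (λ y → y ∉ B × Edge (a , y)) Y

    hasFreeNeighbour? : Decidable HasFreeNeighbour
    hasFreeNeighbour? a = any? (λ y → ¬? (y ∈W? B) ×-dec edge? (a , y)) Y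

    -- By no-free-detour, the first case leaves b without unmatched neighbours.
    star : U × W → List (U × W)
    star (a , b) with hasFreeNeighbour? a
    ... | yes _ = map (a ,_) (outside _≟W_ B Y)
    ... | no _ = map (_, b) (outside _≟U_ A X)

    length-star : ∀ e → length (star e) + σ ≤ length X ⊔ length Y
    length-star (a , b) with hasFreeNeighbour? a
    ... | yes _ = begin
      length (map (a ,_) (outside _≟W_ B Y)) + σ ≡⟨ cong₂ _+_ (length-map (a ,_) (outside _≟W_ B Y)) (sym |B|≡σ) ⟩
      length (outside _≟W_ B Y) + length B       ≤⟨ length-outside _≟W_ B Y (proj₂ (proj₂ matching)) B⊆Y ⟩
      length Y                                   ≤⟨ m≤n⊔m (length X) (length Y) ⟩
      length X ⊔ length Y                        ∎
      where open ≤-Reasoning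
    ... | no _ = begin
      length (map (_, b) (outside _≟U_ A X)) + σ ≡⟨ cong₂ _+_ (length-map (_, b) (outside _≟U_ A X)) (sym |A|≡σ) ⟩
      length (outside _≟U_ A X) + length A       ≤⟨ length-outside _≟U_ A X (proj₁ (proj₂ matching)) A⊆X ⟩
      length X                                   ≤⟨ m≤m⊔n (length X) (length Y) ⟩
      length X ⊔ length Y                        ∎
      where open ≤-Reasoning

    cover : List (U × W)
    cover = cartesianProduct A B ++ concatMap star M

    length-cover : length cover ≤ σ * (length X ⊔ length Y)
    length-cover = begin
      length (cartesianProduct A B ++ concatMap star M)        ≡⟨ length-++ (cartesianProduct A B) ⟩
      length (cartesianProduct A B) + length (concatMap star M) ≡⟨ cong (_+ length (concatMap star M)) |A×B|≡σσ ⟩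
      σ * σ + length (concatMap star M)                         ≡⟨ +-comm (σ * σ) _ ⟩
      length (concatMap star M) + σ * σ                         ≤⟨ subst (λ l → length (concatMap star M) + l * σ ≤ l * (length X ⊔ length Y)) |M|≡σ
                                                                     (length-concatMap-≤ star M σ _ (λ {e} _ → length-star e)) ⟩
      σ * (length X ⊔ length Y)                                 ∎
      where
      open ≤-Reasoning
      |A×B|≡σσ : length (cartesianProduct A B) ≡ σ * σ
      |A×B|≡σσ = trans (length-cartesianProduct A B) (cong₂ _*_ |A|≡σ |B|≡σ)

    row∈star : ∀ {x b y} → (x , b) ∈ M → y ∉ B → Edge (x , y) → (x , y) ∈ star (x , b)
    row∈star {x} {b} {y} xb∈M y∉B xy with hasFreeNeighbour? x
    ... | yes _ = ∈-map⁺ (x ,_) (∈-filter⁺ (λ y → ¬? (y ∈W? B)) (edge-right xy) y∉B)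
    ... | no none = contradiction (Any.map (λ { refl → y∉B , xy }) (edge-right xy)) none

    -- Case x unmatched, y matched to a: a free neighbour of a would give an augmenting
    -- path, so star picks y's column.
    column∈star : ∀ {a y x} → (a , y) ∈ M → x ∉ A → Edge (x , y) → (x , y) ∈ star (a , y)
    column∈star {a} {y} {x} ay∈M x∉A xy with hasFreeNeighbour? a
    ... | yes some with _ , y′∉B , ay′ ← Any.satisfied some = contradiction ay′ λ ay′ → no-free-detour ay∈M x∉A xy y′∉B ay′
    ... | no _ = ∈-map⁺ (_, y) (∈-filter⁺ (λ x → ¬? (x ∈U? A)) (edge-left xy) x∉A)

    edge∈cover : ∀ {x y} → Edge (x , y) → (x , y) ∈ cover
    edge∈cover {x} {y} xy with x ∈U? A | y ∈W? B
    ... | yes x∈A | yes y∈B = ∈-++⁺ˡ (∈-cartesianProduct⁺ x∈A y∈B)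
    ... | no x∉A | no y∉B = contradiction xy (no-free-edge x∉A y∉B)
    ... | yes x∈A | no y∉B with (_ , b) , xb∈M , refl ← ∈-map⁻ proj₁ x∈A =
      ∈-++⁺ʳ (cartesianProduct A B) (∈-concatMap star xb∈M (row∈star xb∈M y∉B xy))
    ... | no x∉A | yes y∈B with (a , _) , ay∈M , refl ← ∈-map⁻ proj₂ y∈B =
      ∈-++⁺ʳ (cartesianProduct A B) (∈-concatMap star ay∈M (column∈star ay∈M x∉A xy))

  edge-cover : (σ : ℕ) → (∃ λ M → IsMatching M × length M ≡ σ) → (∀ ps → IsMatching ps → length ps ≤ σ) →
    ∃ λ C → length C ≤ σ * (length X ⊔ length Y) × (∀ {x y} → Edge (x , y) → (x , y) ∈ C)
  edge-cover σ (M , matching , |M|≡σ) maximal = cover , length-cover , edge∈cover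
    where open MaximumMatching σ M matching |M|≡σ maximal

module Apery (S : NumericalSemigroup) {μ : ℕ} (multiplicity : IsMultiplicity S μ) where

  Ap : ℕ → Set
  Ap = InApery S μ

  μ≢0 : μ ≢ 0
  μ≢0 = proj₁ (proj₂ multiplicity)

  μ-least : ∀ s → Mem S s → s ≢ 0 → μ ≤ s
  μ-least = proj₂ (proj₂ multiplicity)

  μ∉Ap : ¬ Ap μ
  μ∉Ap (_ , not-shift) = not-shift (0 , zero∈ S , refl)

  Ap-summandˡ : ∀ {x y} → Mem S x → Mem S y → Ap (x + y) → Ap x
  Ap-summandˡ {x} {y} x∈S y∈S (_ , not-shift) = x∈S , λ (t , t∈S , t+μ≡x) →
    not-shift (t + y , closed S t∈S y∈S , (begin
      t + y + μ ≡⟨ +-assoc t y μ ⟩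
      t + (y + μ) ≡⟨ cong (t +_) (+-comm y μ) ⟩
      t + (μ + y) ≡⟨ sym (+-assoc t μ y) ⟩
      t + μ + y ≡⟨ cong (_+ y) t+μ≡x ⟩
      x + y ∎))
    where open ≡-Reasoning

  Ap-summandʳ : ∀ {x y} → Mem S x → Mem S y → Ap (x + y) → Ap y
  Ap-summandʳ {x} {y} x∈S y∈S ap = Ap-summandˡ y∈S x∈S (subst Ap (+-comm x y) ap)

  Ap? : ∀ s → Dec (Ap s)
  Ap? s with dec S s | μ ≤? s
  ... | no s∉S | _ = no (λ ap → s∉S (proj₁ ap))
  ... | yes s∈S | no μ≰s = yes (s∈S , λ (t , _ , t+μ≡s) → μ≰s (subst (μ ≤_) t+μ≡s (m≤n+m μ t)))
  ... | yes s∈S | yes μ≤s with dec S (s ∸ μ)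
  ...   | yes s-μ∈S = no (λ ap → proj₂ ap (s ∸ μ , s-μ∈S , m∸n+n≡m μ≤s))
  ...   | no s-μ∉S = yes (s∈S , λ (t , t∈S , t+μ≡s) →
            s-μ∉S (subst (Mem S) (trans (sym (m+n∸n≡m t μ)) (cong (_∸ μ) t+μ≡s)) t∈S))

  -- Nonzero Apéry elements lie below c + μ: otherwise s − μ ≥ c would lie in S.
  Ap-<-c+μ : ∀ {c s} → IsConductor S c → Ap s → s ≢ 0 → s < c + μ
  Ap-<-c+μ {c} {s} conductor (s∈S , not-shift) s≢0 with c ≤? s ∸ μ
  ... | yes c≤s-μ = contradiction (s ∸ μ , proj₁ conductor (s ∸ μ) c≤s-μ , m∸n+n≡m (μ-least s s∈S s≢0)) not-shift
  ... | no c≰s-μ = subst (_< c + μ) (m∸n+n≡m (μ-least s s∈S s≢0)) (+-monoˡ-< μ (≰⇒> c≰s-μ))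

  -- Every residue r < μ is the residue of an Apéry element: starting from an element
  -- r + kμ of S, subtract μ as long as the result stays in S.
  descend : ∀ r → r < μ → ∀ k → Mem S (r + k * μ) → ∃ λ k′ → Ap (r + k′ * μ)
  descend r r<μ zero r∈S = 0 , r∈S , λ (t , _ , t+μ≡r) →
    <⇒≱ r<μ (subst (μ ≤_) (trans t+μ≡r (+-identityʳ r)) (m≤n+m μ t))
  descend r r<μ (suc k) r+μ+kμ∈S with dec S (r + k * μ)
  ... | yes r+kμ∈S = descend r r<μ k r+kμ∈S
  ... | no r+kμ∉S = suc k , r+μ+kμ∈S , λ (t , t∈S , t+μ≡) →
        r+kμ∉S (subst (Mem S) (+-cancelʳ-≡ μ t (r + k * μ) (trans t+μ≡ (step-down r k))) t∈S)
    where
    step-down : ∀ r k → r + suc k * μ ≡ r + k * μ + μ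
    step-down r k = trans (cong (r +_) (+-comm μ (k * μ))) (sym (+-assoc r (k * μ) μ))

  apery-in-residue : ∀ r → r < μ → ∃ λ k → Ap (r + k * μ)
  apery-in-residue r r<μ with N , cofinite-from-N ← cofinite S =
    descend r r<μ N (cofinite-from-N (r + N * μ) (≤-trans (m≤m*n N μ) (m≤n+m (N * μ) r)))
    where instance _ = ≢-nonZero μ≢0

  -- The Apéry set meets all μ residue classes, so any list containing μ (for the class
  -- of 0) and all nonzero Apéry elements has at least μ entries.
  μ-≤-length : (L : List ℕ) → μ ∈ L → (∀ {s} → Ap s → s ≢ 0 → s ∈ L) → μ ≤ length L
  μ-≤-length L μ∈L Ap⊆L = subst (_≤ length L) (length-tabulate representative)
    (unique-length-≤ (tabulate⁺ representative-injective) representatives∈L)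
    where
    instance _ = ≢-nonZero μ≢0

    representativeOf : ∀ r → r < μ → ℕ
    representativeOf zero _ = μ
    representativeOf (suc r) r<μ = suc r + proj₁ (apery-in-residue (suc r) r<μ) * μ

    representative : Fin μ → ℕ
    representative i = representativeOf (toℕ i) (Fin.toℕ<n i)

    residue : ∀ r (r<μ : r < μ) → representativeOf r r<μ % μ ≡ r
    residue zero _ = n%n≡0 μ
    residue (suc r) r<μ = trans ([m+kn]%n≡m%n (suc r) (proj₁ (apery-in-residue (suc r) r<μ)) μ) (m<n⇒m%n≡m r<μ)

    representative-injective : ∀ {i j} → representative i ≡ representative j → i ≡ j
    representative-injective {i} {j} eq = Fin.toℕ-injective (begin
      toℕ i                      ≡⟨ sym (residue (toℕ i) (Fin.toℕ<n i)) ⟩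
      representative i % μ       ≡⟨ cong (_% μ) eq ⟩
      representative j % μ       ≡⟨ residue (toℕ j) (Fin.toℕ<n j) ⟩
      toℕ j                      ∎)
      where open ≡-Reasoning

    representative∈L : ∀ r (r<μ : r < μ) → representativeOf r r<μ ∈ L
    representative∈L zero _ = μ∈L
    representative∈L (suc r) r<μ = Ap⊆L (proj₂ (apery-in-residue (suc r) r<μ)) (λ ())

    representatives∈L : ∀ {s} → s ∈ tabulate representative → s ∈ L
    representatives∈L s∈ with i , refl ← ∈-tabulate⁻ s∈ = representative∈L (toℕ i) (Fin.toℕ<n i)

head-<-tail : ∀ {a g l} → StrictlyIncreasing (a ∷ l) → g ∈ l → a < g
head-<-tail (a<b ∷ _) (here refl) = a<b
head-<-tail (a<b ∷ increasing) (there g∈l) = <-trans a<b (head-<-tail increasing g∈l)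

least-is-head : ∀ {m l} → StrictlyIncreasing l → m ∈ l → (∀ {a} → a ∈ l → m ≤ a) → ∃ λ l′ → l ≡ m ∷ l′
least-is-head {l = a ∷ l′} increasing (here refl) least = l′ , refl
least-is-head {l = a ∷ l′} increasing (there m∈l′) least =
  contradiction (least (here refl)) (<⇒≱ (head-<-tail increasing m∈l′))

module Generators (S : NumericalSemigroup) {gens : List ℕ} (minGens : IsMinGenList S gens)
  {μ : ℕ} (multiplicity : IsMultiplicity S μ) where

  open Apery S multiplicity

  ∈gens⇒minGen : ∀ {a} → a ∈ gens → IsMinGen S a
  ∈gens⇒minGen {a} = proj₁ (proj₂ minGens a)

  -- A sum of two positive elements exceeds μ, so μ is a minimal generator.
  μ∈gens : μ ∈ gens
  μ∈gens = proj₂ (proj₂ minGens μ) (proj₁ multiplicity , μ≢0 , λ (x , y , x∈S , y∈S , x≢0 , y≢0 , x+y≡μ) →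
    <-irrefl (sym x+y≡μ) (≤-<-trans (μ-least x x∈S x≢0) (m<m+n x (n≢0⇒n>0 y≢0))))

  gens-start-with-μ : ∃ λ l → gens ≡ μ ∷ l
  gens-start-with-μ = least-is-head (proj₁ minGens) μ∈gens λ a∈gens →
    let (a∈S , a≢0 , _) = ∈gens⇒minGen a∈gens in μ-least _ a∈S a≢0

  Splits : ℕ → Set
  Splits s = Σ ℕ λ x → Σ ℕ λ y → Mem S x × Mem S y × x ≢ 0 × y ≢ 0 × x + y ≡ s

  ¬gen⇒¬¬splits : ∀ {s} → Mem S s → s ≢ 0 → s ∉ gens → ¬ ¬ Splits s
  ¬gen⇒¬¬splits s∈S s≢0 s∉gens ¬splits = s∉gens (proj₂ (proj₂ minGens _) (s∈S , s≢0 , ¬splits))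

tail-above-third : ∀ {K a g l} → StrictlyIncreasing (a ∷ l) →
  (∀ a₂ rest → l ≡ a₂ ∷ rest → K < 3 * a₂) → g ∈ l → K < 3 * g
tail-above-third {l = a₂ ∷ rest} (_ ∷ increasing) second-above g∈l =
  <-≤-trans (second-above a₂ rest refl) (*-monoʳ-≤ 3 (second-≤ g∈l))
  where
  second-≤ : ∀ {g} → g ∈ a₂ ∷ rest → a₂ ≤ g
  second-≤ (here refl) = ≤-refl
  second-≤ (there g∈rest) = <⇒≤ (head-<-tail increasing g∈rest)

double-≤-sum : ∀ {x y} → x ≤ y → 2 * x ≤ x + y
double-≤-sum {x} x≤y = +-monoʳ-≤ x (≤-trans (≤-reflexive (+-identityʳ x)) x≤y)

three-thirds : ∀ {K a b d} → K < 3 * a → K < 3 * b → K < 3 * d → K < a + b + d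
three-thirds {K} {a} {b} {d} K<3a K<3b K<3d = *-cancelˡ-≤ 3 (begin
  3 * suc K                   ≡⟨ thrice (suc K) ⟩
  suc K + suc K + suc K       ≤⟨ +-mono-≤ (+-mono-≤ K<3a K<3b) K<3d ⟩
  3 * a + 3 * b + 3 * d       ≡⟨ distribute a b d ⟩
  3 * (a + b + d)             ∎)
  where
  open ≤-Reasoning
  thrice : ∀ n → 3 * n ≡ n + n + n
  thrice = solve-∀
  distribute : ∀ a b d → 3 * a + 3 * b + 3 * d ≡ 3 * (a + b + d)
  distribute = solve-∀

below-two-thirds : ∀ {K a b} → K < 3 * a → a + b < K → 3 * b < 2 * K
below-two-thirds {K} {a} {b} K<3a a+b<K = +-cancelˡ-< K (3 * b) (2 * K) (begin-strict
  K + 3 * b            <⟨ +-monoˡ-< (3 * b) K<3a ⟩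
  3 * a + 3 * b        ≡⟨ *-distribˡ-+ 3 a b ⟨
  3 * (a + b)          <⟨ *-monoʳ-< 3 a+b<K ⟩
  3 * K                ∎)
  where open ≤-Reasoning

module Bound (S : NumericalSemigroup) (gens : List ℕ) (c μ σ : ℕ)
  (minGens : IsMinGenList S gens) (conductor : IsConductor S c) (multiplicity : IsMultiplicity S μ)
  (second-above : ∀ a₁ a₂ rest → gens ≡ a₁ ∷ a₂ ∷ rest → c + μ < 3 * a₂) where

  open Apery S multiplicity
  open Generators S minGens multiplicity

  -- Every minimal generator other than μ exceeds (c + μ)/3.
  generator-above-third : ∀ {g} → g ∈ gens → g ≢ μ → c + μ < 3 * g
  generator-above-third {g} g∈gens g≢μ with l , gens≡μ∷l ← gens-start-with-μ with subst (g ∈_) gens≡μ∷l g∈gens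
  ... | here g≡μ = contradiction g≡μ g≢μ
  ... | there g∈l = tail-above-third (subst StrictlyIncreasing gens≡μ∷l (proj₁ minGens))
          (λ a₂ rest l≡ → second-above μ a₂ rest (trans gens≡μ∷l (cong (μ ∷_) l≡))) g∈l

  -- Hence so does every positive Apéry element (strong induction: a positive Apéry
  -- element is a generator other than μ, or has a smaller positive Apéry summand).
  Ap-above-third : ∀ {z} → Ap z → z ≢ 0 → c + μ < 3 * z
  Ap-above-third {z} = <-rec (λ z → Ap z → z ≢ 0 → c + μ < 3 * z) step z
    where
    step : ∀ z → (∀ {x} → x < z → Ap x → x ≢ 0 → c + μ < 3 * x) → Ap z → z ≢ 0 → c + μ < 3 * z
    step z below ap z≢0 with z ∈? gens
    ... | yes z∈gens = generator-above-third z∈gens λ z≡μ → μ∉Ap (subst Ap z≡μ ap)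
    ... | no z∉gens = decidable-stable (c + μ <? 3 * z) λ ¬above →
          ¬gen⇒¬¬splits (proj₁ ap) z≢0 z∉gens λ (x , y , x∈S , y∈S , x≢0 , y≢0 , x+y≡z) →
            let x<z = subst (x <_) x+y≡z (m<m+n x (n≢0⇒n>0 y≢0))
                x-above = below x<z (Ap-summandˡ x∈S y∈S (subst Ap (sym x+y≡z) ap)) x≢0
            in ¬above (<-≤-trans x-above (*-monoʳ-≤ 3 (<⇒≤ x<z)))

  -- If a positive Apéry element is a sum of two positive elements of S, each summand is a
  -- minimal generator: splitting a summand further would write an Apéry element below
  -- c + μ as a sum of three Apéry elements above (c + μ)/3.
  Ap-summand-generator : ∀ {x y} → Mem S x → Mem S y → x ≢ 0 → y ≢ 0 → Ap (x + y) → x ∈ gens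
  Ap-summand-generator {x} {y} x∈S y∈S x≢0 y≢0 ap = decidable-stable (x ∈? gens) λ x∉gens →
    ¬gen⇒¬¬splits x∈S x≢0 x∉gens λ (x₁ , x₂ , x₁∈S , x₂∈S , x₁≢0 , x₂≢0 , x₁+x₂≡x) →
      let apx = subst Ap (sym x₁+x₂≡x) (Ap-summandˡ x∈S y∈S ap)
          x+y<c+μ = Ap-<-c+μ conductor ap (λ x+y≡0 → x≢0 (m+n≡0⇒m≡0 x x+y≡0))
      in <-asym x+y<c+μ (subst (λ x → c + μ < x + y) x₁+x₂≡x
           (three-thirds {a = x₁} {x₂} {y} (Ap-above-third (Ap-summandˡ x₁∈S x₂∈S apx) x₁≢0)
                         (Ap-above-third (Ap-summandʳ x₁∈S x₂∈S apx) x₂≢0)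
                         (Ap-above-third (Ap-summandʳ x∈S y∈S ap) y≢0)))

  P1 P2 : List ℕ
  P1 = P₁ c μ gens
  P2 = P₂ c μ gens

  module Covering (C : List (ℕ × ℕ)) (pairs∈C : ∀ {x y} → IsAperyPair S c μ gens (x , y) → (x , y) ∈ C) where

    Sums : List ℕ
    Sums = pairSums P1 ++ map (uncurry _+_) C

    Cover : List ℕ
    Cover = gens ++ Sums

    ordered-sum∈Sums : ∀ {x y} → x ∈ gens → y ∈ gens → x ≢ μ → y ≢ μ → x ≤ y →
      x + y < c + μ → Ap (x + y) → x + y ∈ Sums
    ordered-sum∈Sums {x} {y} x∈gens y∈gens x≢μ y≢μ x≤y x+y<c+μ ap = by-size-of-y (2 * y <? c + μ)
      where
      x-above : c + μ < 3 * x
      x-above = generator-above-third x∈gens x≢μ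

      x∈P1 : x ∈ P1
      x∈P1 = ∈-filter⁺ (InP₁cond? c μ) x∈gens
               (x≢μ , x-above , ≤-<-trans (double-≤-sum x≤y) x+y<c+μ)

      by-size-of-y : Dec (2 * y < c + μ) → x + y ∈ Sums
      by-size-of-y (yes 2y<c+μ) = ∈-++⁺ˡ (∈-pairSums x∈P1
        (∈-filter⁺ (InP₁cond? c μ) y∈gens (y≢μ , <-≤-trans x-above (*-monoʳ-≤ 3 x≤y) , 2y<c+μ)))
      by-size-of-y (no 2y≮c+μ) = ∈-++⁺ʳ (pairSums P1) (∈-map⁺ (uncurry _+_) (pairs∈C (x∈P1 , y∈P2 , ap)))
        where
        y∈P2 : y ∈ P2
        y∈P2 = ∈-filter⁺ (InP₂cond? c μ) y∈gens (y≢μ , ≮⇒≥ 2y≮c+μ , below-two-thirds {a = x} {y} x-above x+y<c+μ)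

    sum∈Sums : ∀ {x y} → Mem S x → Mem S y → x ≢ 0 → y ≢ 0 → Ap (x + y) → x + y ∈ Sums
    sum∈Sums {x} {y} x∈S y∈S x≢0 y≢0 ap = by-order (x ≤? y)
      where
      x∈gens : x ∈ gens
      x∈gens = Ap-summand-generator x∈S y∈S x≢0 y≢0 ap
      y∈gens : y ∈ gens
      y∈gens = Ap-summand-generator y∈S x∈S y≢0 x≢0 (subst Ap (+-comm x y) ap)
      x≢μ : x ≢ μ
      x≢μ x≡μ = μ∉Ap (subst Ap x≡μ (Ap-summandˡ x∈S y∈S ap))
      y≢μ : y ≢ μ
      y≢μ y≡μ = μ∉Ap (subst Ap y≡μ (Ap-summandʳ x∈S y∈S ap))
      x+y<c+μ : x + y < c + μ
      x+y<c+μ = Ap-<-c+μ conductor ap (λ x+y≡0 → x≢0 (m+n≡0⇒m≡0 x x+y≡0))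

      by-order : Dec (x ≤ y) → x + y ∈ Sums
      by-order (yes x≤y) = ordered-sum∈Sums x∈gens y∈gens x≢μ y≢μ x≤y x+y<c+μ ap
      by-order (no x≰y) = subst (_∈ Sums) (+-comm y x)
        (ordered-sum∈Sums y∈gens x∈gens y≢μ x≢μ (<⇒≤ (≰⇒> x≰y)) (subst (_< c + μ) (+-comm x y) x+y<c+μ)
          (subst Ap (+-comm x y) ap))

    Ap⊆Cover : ∀ {s} → Ap s → s ≢ 0 → s ∈ Cover
    Ap⊆Cover {s} ap s≢0 with s ∈? gens
    ... | yes s∈gens = ∈-++⁺ˡ s∈gens
    ... | no s∉gens = decidable-stable (s ∈? Cover) λ s∉Cover →
          ¬gen⇒¬¬splits (proj₁ ap) s≢0 s∉gens λ (x , y , x∈S , y∈S , x≢0 , y≢0 , x+y≡s) →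
            s∉Cover (∈-++⁺ʳ gens (subst (_∈ Sums) x+y≡s (sum∈Sums x∈S y∈S x≢0 y≢0 (subst Ap (sym x+y≡s) ap))))

  -- The Apéry pairs form a bipartite graph between P₁ and P₂ whose matchings are the
  -- independent sets, so the Kőnig-type bound applies.
  apery-pair-cover : IsMaxIndepSize S c μ gens σ →
    ∃ λ C → length C ≤ σ * (length P1 ⊔ length P2) × (∀ {x y} → IsAperyPair S c μ gens (x , y) → (x , y) ∈ C)
  apery-pair-cover (maximum , maximal) = edge-cover σ maximum maximal
    where
    open BipartiteGraph _≟_ _≟_ (IsAperyPair S c μ gens)
      (λ (x , y) → (x ∈? P1) ×-dec (y ∈? P2) ×-dec Ap? (x + y)) P1 P2 proj₁ (λ pair → proj₁ (proj₂ pair))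

corollary4p2 : (S : NumericalSemigroup) (gens : List ℕ) (c μ σ : ℕ) →
    IsMinGenList S gens → IsConductor S c → IsMultiplicity S μ →
    (∀ a₁ a₂ rest → gens ≡ a₁ ∷ a₂ ∷ rest → c + μ < 3 * a₂) →
    IsMaxIndepSize S c μ gens σ →
    μ ≤ (length (P₁ c μ gens) * (length (P₁ c μ gens) + 1)) / 2
          + σ * (length (P₁ c μ gens) ⊔ length (P₂ c μ gens)) + length gens
corollary4p2 S gens c μ σ minGens conductor multiplicity second-above maxIndep = begin
  μ                                                           ≤⟨ μ-≤-length Cover (∈-++⁺ˡ μ∈gens) Ap⊆Cover ⟩
  length (gens ++ Sums)                                       ≡⟨ trans (length-++ gens) (+-comm (length gens) _) ⟩
  length (pairSums P1 ++ map (uncurry _+_) C) + length gens    ≡⟨ cong (_+ length gens) (length-++ (pairSums P1)) ⟩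
  length (pairSums P1) + length (map (uncurry _+_) C) + length gens
    ≤⟨ +-monoˡ-≤ (length gens) (+-mono-≤ (≤-reflexive (length-pairSums P1)) |sums-of-pairs|≤) ⟩
  length P1 * (length P1 + 1) / 2 + σ * (length P1 ⊔ length P2) + length gens ∎
  where
  open ≤-Reasoning
  open Bound S gens c μ σ minGens conductor multiplicity second-above
  open Apery S multiplicity using (μ-≤-length)
  open Generators S minGens multiplicity using (μ∈gens)

  C : List (ℕ × ℕ)
  C = proj₁ (apery-pair-cover maxIndep)

  open Covering C (proj₂ (proj₂ (apery-pair-cover maxIndep)))

  |sums-of-pairs|≤ : length (map (uncurry _+_) C) ≤ σ * (length P1 ⊔ length P2)
  |sums-of-pairs|≤ = ≤-trans (≤-reflexive (length-map (uncurry _+_) C)) (proj₁ (proj₂ (apery-pair-cover maxIndep)))
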